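{- Let $\mathbf{t}_1,\dots,\mathbf{t}_r\in\mathbb{N}^s$ satisfy: (1) for every $1\le i\le s$ there is $1\le j\le r$ with $\mathbf{t}_j(i)\neq 0$; (2) for every distinct $i,i'\in\{1,\dots,s\}$ there is $1\le j\le r$ with $\mathbf{t}_j(i)\neq\mathbf{t}_j(i')$. Then there exists an integer $c>0$ such that for every $\mathbf{b}\in\mathbb{Z}^s$ all of whose entries are divisible by $c$, there is a multivariate polynomial $p(x_1,\dots,x_r)$ with integer coefficients, of degree $s$, with $p(0,\dots,0)=0$, such that $p(\mathbf{t}_1(i),\dots,\mathbf{t}_r(i))=\mathbf{b}(i)$ for each $1\le i\le s$.
   Context: $\mathbb{N}$ denotes the non-negative integers; for a tuple $\mathbf{t}$, $\mathbf{t}(i)$ is its $i$-th entry. -}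

module Defs where

open import Data.Nat using (ℕ; _≤_)
open import Data.Integer using (ℤ; +_; _+_; _*_; _^_)
open import Data.Fin using (Fin)
import Data.Fin as Fin
import Data.Nat
open import Data.List using (List; []; _∷_)
open import Data.List.Relation.Unary.All using (All)
open import Data.Product using (_×_; _,_; proj₂)

sumFin : ∀ {r} → (Fin r → ℕ) → ℕ
sumFin {ℕ.zero} f = 0
sumFin {ℕ.suc r} f = f Fin.zero Data.Nat.+ sumFin (λ k → f (Fin.suc k))

prodFin : ∀ {r} → (Fin r → ℤ) → ℤ
prodFin {ℕ.zero} f = + 1
prodFin {ℕ.suc r} f = f Fin.zero * prodFin (λ k → f (Fin.suc k))

Monomial : ℕ → Set
Monomial r = ℤ × (Fin r → ℕ)

Poly : ℕ → Set
Poly r = List (Monomial r)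

evalMono : ∀ {r} → Monomial r → (Fin r → ℤ) → ℤ
evalMono (a , e) x = a * prodFin (λ j → x j ^ e j)

eval : ∀ {r} → Poly r → (Fin r → ℤ) → ℤ
eval [] x = + 0
eval (m ∷ p) x = evalMono m x + eval p x

DegreeAtMost : ∀ {r} → Poly r → ℕ → Set
DegreeAtMost p d = All (λ m → sumFin (proj₂ m) ≤ d) p

{-# OPTIONS --safe #-}
-- For each i, the polynomial qᵢ = ∏ₖ ℓᵢₖ, where ℓᵢᵢ = xⱼ for a coordinate j with
-- tⱼ(i) ≠ 0 and, for k ≠ i, ℓᵢₖ = xⱼ − tⱼ(k) for a coordinate j separating i from k,
-- has degree s, vanishes at the origin and at every tₖ with k ≠ i, but not at tᵢ.
-- With c = |∏ᵢ qᵢ(tᵢ)|, every b divisible by c is interpolated by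
-- p = ∑ᵢ (bᵢ / qᵢ(tᵢ)) qᵢ, whose coefficients are then integers.
module Submission where

open import Defs
open import Data.Nat using (ℕ; _<_)
open import Data.Integer using (ℤ; +_)
open import Data.Integer.Divisibility using (_∣_)
open import Data.Fin using (Fin)
open import Data.Product using (Σ; _×_; ∃)
open import Relation.Binary.PropositionalEquality using (_≡_; _≢_)

import Algebra.Properties.CommutativeMonoid.Sum as CommutativeMonoidSum
open import Data.Nat using (zero; suc; _≤_; z≤n)
import Data.Nat as ℕ
import Data.Nat.Properties as ℕ
open import Data.Integer using (0ℤ; 1ℤ; _+_; _*_; _-_; -_; ∣_∣; _^_)
import Data.Integer.Properties as ℤ
open import Algebra.Properties.CommutativeSemigroup ℤ.*-commutativeSemigroup using (interchange)
import Data.Integer.Divisibility.Signed as Signed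
open import Data.Fin using (punchIn; _≟_) renaming (zero to fzero; suc to fsuc)
open import Data.Fin.Properties using (punchInᵢ≢i)
open import Data.List using (_++_; map; []; _∷_)
import Data.List.Relation.Unary.All as All
open import Data.List.Relation.Unary.All using ([]; _∷_)
open import Data.List.Relation.Unary.All.Properties using (++⁺; map⁺)
open import Data.Product using (_,_; proj₁; proj₂; map₂)
open import Data.Sum using (inj₁; inj₂)
open import Function using (_∘_)
open import Relation.Nullary using (Dec; yes; no; contradiction)
open import Relation.Binary.PropositionalEquality using (refl; sym; trans; cong; cong₂; subst; module ≡-Reasoning)

open CommutativeMonoidSum ℕ.+-0-commutativeMonoid using ()
  renaming (sum to ∑ℕ; ∑-distrib-+ to ∑ℕ-distrib-+)
open CommutativeMonoidSum ℤ.+-0-commutativeMonoid using ()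
  renaming (sum to ∑; sum-remove to ∑-remove; sum-cong-≗ to ∑-cong; sum-replicate-zero to ∑-zero)
open CommutativeMonoidSum ℤ.*-1-commutativeMonoid using ()
  renaming (sum to ∏; sum-remove to ∏-remove; sum-cong-≗ to ∏-cong; ∑-distrib-+ to ∏-distrib-*; sum-replicate-zero to ∏-one)

sumFin≡∑ℕ : ∀ {r} (f : Fin r → ℕ) → sumFin f ≡ ∑ℕ f
sumFin≡∑ℕ {zero} f = refl
sumFin≡∑ℕ {suc r} f = cong (f fzero ℕ.+_) (sumFin≡∑ℕ (f ∘ fsuc))

prodFin≡∏ : ∀ {r} (f : Fin r → ℤ) → prodFin f ≡ ∏ f
prodFin≡∏ {zero} f = refl
prodFin≡∏ {suc r} f = cong (f fzero *_) (prodFin≡∏ (f ∘ fsuc))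

sumFin-+ : ∀ {r} (e f : Fin r → ℕ) → sumFin (λ k → e k ℕ.+ f k) ≡ sumFin e ℕ.+ sumFin f
sumFin-+ e f = begin
  sumFin (λ k → e k ℕ.+ f k)  ≡⟨ sumFin≡∑ℕ (λ k → e k ℕ.+ f k) ⟩
  ∑ℕ (λ k → e k ℕ.+ f k)      ≡⟨ ∑ℕ-distrib-+ e f ⟩
  ∑ℕ e ℕ.+ ∑ℕ f               ≡⟨ sym (cong₂ ℕ._+_ (sumFin≡∑ℕ e) (sumFin≡∑ℕ f)) ⟩
  sumFin e ℕ.+ sumFin f       ∎
  where open ≡-Reasoning

sumFin-zero : ∀ {r} → sumFin {r} (λ _ → 0) ≡ 0
sumFin-zero {zero} = refl
sumFin-zero {suc r} = sumFin-zero {r}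

prodFin-cong : ∀ {r} {f g : Fin r → ℤ} → (∀ k → f k ≡ g k) → prodFin f ≡ prodFin g
prodFin-cong {f = f} {g} f≗g = trans (prodFin≡∏ f) (trans (∏-cong f≗g) (sym (prodFin≡∏ g)))

prodFin-* : ∀ {r} (f g : Fin r → ℤ) → prodFin (λ k → f k * g k) ≡ prodFin f * prodFin g
prodFin-* f g = begin
  prodFin (λ k → f k * g k)  ≡⟨ prodFin≡∏ (λ k → f k * g k) ⟩
  ∏ (λ k → f k * g k)        ≡⟨ ∏-distrib-* f g ⟩
  ∏ f * ∏ g                  ≡⟨ sym (cong₂ _*_ (prodFin≡∏ f) (prodFin≡∏ g)) ⟩
  prodFin f * prodFin g      ∎
  where open ≡-Reasoning

prodFin-one : ∀ {r} → prodFin {r} (λ _ → 1ℤ) ≡ 1ℤ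
prodFin-one {r} = trans (prodFin≡∏ {r} (λ _ → 1ℤ)) (∏-one r)

δ : ∀ {r} → Fin r → Fin r → ℕ
δ fzero fzero = 1
δ fzero (fsuc _) = 0
δ (fsuc _) fzero = 0
δ (fsuc j) (fsuc k) = δ j k

sumFin-δ : ∀ {r} (j : Fin r) → sumFin (δ j) ≡ 1
sumFin-δ {suc r} fzero = cong suc (sumFin-zero {r})
sumFin-δ {suc r} (fsuc j) = sumFin-δ j

prodFin-^δ : ∀ {r} (x : Fin r → ℤ) (j : Fin r) → prodFin (λ k → x k ^ δ j k) ≡ x j
prodFin-^δ {suc r} x fzero = begin
  x fzero * 1ℤ * prodFin {r} (λ _ → 1ℤ)  ≡⟨ cong (x fzero * 1ℤ *_) (prodFin-one {r}) ⟩
  x fzero * 1ℤ * 1ℤ                      ≡⟨ trans (ℤ.*-identityʳ _) (ℤ.*-identityʳ _) ⟩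
  x fzero                                ∎
  where open ≡-Reasoning
prodFin-^δ {suc r} x (fsuc j) = trans (ℤ.*-identityˡ _) (prodFin-^δ (x ∘ fsuc) j)

∑-single : ∀ {n} (f : Fin n → ℤ) (k : Fin n) → (∀ i → i ≢ k → f i ≡ 0ℤ) → ∑ f ≡ f k
∑-single {suc n} f k f≡0 = begin
  ∑ f                          ≡⟨ ∑-remove {i = k} f ⟩
  f k + ∑ (f ∘ punchIn k)      ≡⟨ cong (_+_ (f k)) (∑-cong λ i → f≡0 _ (punchInᵢ≢i k i)) ⟩
  f k + ∑ {n} (λ _ → 0ℤ)       ≡⟨ cong (_+_ (f k)) (∑-zero n) ⟩
  f k + 0ℤ                     ≡⟨ ℤ.+-identityʳ (f k) ⟩
  f k                          ∎
  where open ≡-Reasoning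

∏-≡0 : ∀ {n} (f : Fin n → ℤ) (k : Fin n) → f k ≡ 0ℤ → ∏ f ≡ 0ℤ
∏-≡0 {suc n} f k fk≡0 = begin
  ∏ f                      ≡⟨ ∏-remove {i = k} f ⟩
  f k * ∏ (f ∘ punchIn k)  ≡⟨ cong (_* ∏ (f ∘ punchIn k)) fk≡0 ⟩
  0ℤ * ∏ (f ∘ punchIn k)   ≡⟨ ℤ.*-zeroˡ (∏ (f ∘ punchIn k)) ⟩
  0ℤ                       ∎
  where open ≡-Reasoning

∏-≢0 : ∀ {n} (f : Fin n → ℤ) → (∀ k → f k ≢ 0ℤ) → ∏ f ≢ 0ℤ
∏-≢0 {zero} f f≢0 ()
∏-≢0 {suc n} f f≢0 ∏≡0 with ℤ.i*j≡0⇒i≡0∨j≡0 (f fzero) ∏≡0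
... | inj₁ f₀≡0 = f≢0 fzero f₀≡0
... | inj₂ ∏₁≡0 = ∏-≢0 (f ∘ fsuc) (f≢0 ∘ fsuc) ∏₁≡0

∣∏ : ∀ {n} (f : Fin n → ℤ) (k : Fin n) → f k Signed.∣ ∏ f
∣∏ {suc n} f k = subst (f k Signed.∣_) (sym (∏-remove {i = k} f)) (Signed.∣m⇒∣m*n (∏ (f ∘ punchIn k)) Signed.∣-refl)

const : ∀ {r} → ℤ → Poly r
const a = (a , λ _ → 0) ∷ []

var : ∀ {r} → Fin r → Poly r
var j = (1ℤ , δ j) ∷ []

_*ₘ_ : ∀ {r} → Monomial r → Monomial r → Monomial r
(a , e) *ₘ (b , f) = (a * b , λ k → e k ℕ.+ f k)

infixl 7 _*ₚ_
_*ₚ_ : ∀ {r} → Poly r → Poly r → Poly r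
[] *ₚ q = []
(m ∷ p) *ₚ q = map (m *ₘ_) q ++ p *ₚ q

∏ₚ : ∀ {r s} → (Fin s → Poly r) → Poly r
∏ₚ {s = zero} f = const 1ℤ
∏ₚ {s = suc s} f = f fzero *ₚ ∏ₚ (f ∘ fsuc)

∑ₚ : ∀ {r s} → (Fin s → Poly r) → Poly r
∑ₚ {s = zero} f = []
∑ₚ {s = suc s} f = f fzero ++ ∑ₚ (f ∘ fsuc)

module _ {r : ℕ} (x : Fin r → ℤ) where

  eval-const : ∀ a → eval (const a) x ≡ a
  eval-const a = trans (ℤ.+-identityʳ _) (trans (cong (a *_) (prodFin-one {r})) (ℤ.*-identityʳ a))

  eval-var : ∀ j → eval (var j) x ≡ x j
  eval-var j = trans (ℤ.+-identityʳ _) (trans (ℤ.*-identityˡ _) (prodFin-^δ x j))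

  eval-++ : ∀ (p q : Poly r) → eval (p ++ q) x ≡ eval p x + eval q x
  eval-++ [] q = sym (ℤ.+-identityˡ _)
  eval-++ (m ∷ p) q = trans (cong (_+_ (evalMono m x)) (eval-++ p q)) (sym (ℤ.+-assoc (evalMono m x) (eval p x) (eval q x)))

  evalMono-*ₘ : ∀ (m n : Monomial r) → evalMono (m *ₘ n) x ≡ evalMono m x * evalMono n x
  evalMono-*ₘ (a , e) (b , f) = begin
    a * b * prodFin (λ k → x k ^ (e k ℕ.+ f k))       ≡⟨ cong (a * b *_) (prodFin-cong λ k → ℤ.^-distribˡ-+-* (x k) (e k) (f k)) ⟩
    a * b * prodFin (λ k → x k ^ e k * x k ^ f k)     ≡⟨ cong (a * b *_) (prodFin-* (λ k → x k ^ e k) (λ k → x k ^ f k)) ⟩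
    a * b * (prodFin (λ k → x k ^ e k) * prodFin (λ k → x k ^ f k))
      ≡⟨ interchange a b (prodFin (λ k → x k ^ e k)) (prodFin (λ k → x k ^ f k)) ⟩
    a * prodFin (λ k → x k ^ e k) * (b * prodFin (λ k → x k ^ f k))  ∎
    where open ≡-Reasoning

  eval-map-*ₘ : ∀ m (q : Poly r) → eval (map (m *ₘ_) q) x ≡ evalMono m x * eval q x
  eval-map-*ₘ m [] = sym (ℤ.*-zeroʳ (evalMono m x))
  eval-map-*ₘ m (n ∷ q) = trans (cong₂ _+_ (evalMono-*ₘ m n) (eval-map-*ₘ m q))
    (sym (ℤ.*-distribˡ-+ (evalMono m x) (evalMono n x) (eval q x)))

  eval-*ₚ : ∀ (p q : Poly r) → eval (p *ₚ q) x ≡ eval p x * eval q x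
  eval-*ₚ [] q = sym (ℤ.*-zeroˡ (eval q x))
  eval-*ₚ (m ∷ p) q = begin
    eval (map (m *ₘ_) q ++ p *ₚ q) x               ≡⟨ eval-++ (map (m *ₘ_) q) (p *ₚ q) ⟩
    eval (map (m *ₘ_) q) x + eval (p *ₚ q) x       ≡⟨ cong₂ _+_ (eval-map-*ₘ m q) (eval-*ₚ p q) ⟩
    evalMono m x * eval q x + eval p x * eval q x  ≡⟨ ℤ.*-distribʳ-+ (eval q x) (evalMono m x) (eval p x) ⟨
    (evalMono m x + eval p x) * eval q x           ∎
    where open ≡-Reasoning

  eval-∏ₚ : ∀ {s} (f : Fin s → Poly r) → eval (∏ₚ f) x ≡ ∏ (λ k → eval (f k) x)
  eval-∏ₚ {zero} f = eval-const 1ℤ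
  eval-∏ₚ {suc s} f = trans (eval-*ₚ (f fzero) (∏ₚ (f ∘ fsuc))) (cong (_*_ (eval (f fzero) x)) (eval-∏ₚ (f ∘ fsuc)))

  eval-∑ₚ : ∀ {s} (f : Fin s → Poly r) → eval (∑ₚ f) x ≡ ∑ (λ k → eval (f k) x)
  eval-∑ₚ {zero} f = refl
  eval-∑ₚ {suc s} f = trans (eval-++ (f fzero) (∑ₚ (f ∘ fsuc))) (cong (_+_ (eval (f fzero) x)) (eval-∑ₚ (f ∘ fsuc)))

module _ {r : ℕ} where

  const-degree : ∀ a d → DegreeAtMost {r} (const a) d
  const-degree a d = subst (_≤ d) (sym (sumFin-zero {r})) z≤n ∷ []

  var-degree : ∀ (j : Fin r) → DegreeAtMost (var j) 1
  var-degree j = ℕ.≤-reflexive (sumFin-δ j) ∷ []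

  *ₚ-degree : ∀ {d d′} (p q : Poly r) → DegreeAtMost p d → DegreeAtMost q d′ → DegreeAtMost (p *ₚ q) (d ℕ.+ d′)
  *ₚ-degree [] q _ _ = []
  *ₚ-degree {d} {d′} ((a , e) ∷ p) q (deg-e ∷ deg-p) deg-q =
    ++⁺ (map⁺ (All.map (λ {n} → mono-degree {n}) deg-q)) (*ₚ-degree p q deg-p deg-q)
    where
    mono-degree : ∀ {n : Monomial r} → sumFin (proj₂ n) ≤ d′ → sumFin (λ k → e k ℕ.+ proj₂ n k) ≤ d ℕ.+ d′
    mono-degree {n} deg-n = subst (_≤ d ℕ.+ d′) (sym (sumFin-+ e (proj₂ n))) (ℕ.+-mono-≤ deg-e deg-n)

  ∏ₚ-degree : ∀ {s} (f : Fin s → Poly r) → (∀ k → DegreeAtMost (f k) 1) → DegreeAtMost (∏ₚ f) s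
  ∏ₚ-degree {zero} f _ = const-degree 1ℤ 0
  ∏ₚ-degree {suc s} f deg-f = *ₚ-degree (f fzero) (∏ₚ (f ∘ fsuc)) (deg-f fzero) (∏ₚ-degree (f ∘ fsuc) (deg-f ∘ fsuc))

  ∑ₚ-degree : ∀ {s d} (f : Fin s → Poly r) → (∀ k → DegreeAtMost (f k) d) → DegreeAtMost (∑ₚ f) d
  ∑ₚ-degree {zero} f _ = []
  ∑ₚ-degree {suc s} f deg-f = ++⁺ (deg-f fzero) (∑ₚ-degree (f ∘ fsuc) (deg-f ∘ fsuc))

module Interpolation {r s : ℕ} (P : Fin s → Fin r → ℤ)
  (nonzero-coordinate : ∀ i → ∃ λ j → P i j ≢ 0ℤ)
  (separating-coordinate : ∀ i k → i ≢ k → ∃ λ j → P i j ≢ P k j) where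

  origin : Fin r → ℤ
  origin _ = 0ℤ

  separator : ∀ i k → k ≢ i → Fin r
  separator i k k≢i = proj₁ (separating-coordinate i k (k≢i ∘ sym))

  factor : ∀ i k → Dec (k ≡ i) → Poly r
  factor i k (yes _) = var (proj₁ (nonzero-coordinate i))
  factor i k (no k≢i) = var j ++ const (- P k j)
    where j = separator i k k≢i

  eval-separating-factor : ∀ i k (k≢i : k ≢ i) x → eval (factor i k (no k≢i)) x ≡ x (separator i k k≢i) - P k (separator i k k≢i)
  eval-separating-factor i k k≢i x = trans (eval-++ x (var j) (const (- P k j))) (cong₂ _+_ (eval-var x j) (eval-const x (- P k j)))
    where j = separator i k k≢i

  factor-degree : ∀ i k (k≟i : Dec (k ≡ i)) → DegreeAtMost (factor i k k≟i) 1
  factor-degree i k (yes _) = var-degree (proj₁ (nonzero-coordinate i))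
  factor-degree i k (no k≢i) = ++⁺ (var-degree (separator i k k≢i)) (const-degree (- P k (separator i k k≢i)) 1)

  factor-origin : ∀ i (i≟i : Dec (i ≡ i)) → eval (factor i i i≟i) origin ≡ 0ℤ
  factor-origin i (yes _) = eval-var origin (proj₁ (nonzero-coordinate i))
  factor-origin i (no i≢i) = contradiction refl i≢i

  factor-vanishes : ∀ i k → i ≢ k → (k≟i : Dec (k ≡ i)) → eval (factor i k k≟i) (P k) ≡ 0ℤ
  factor-vanishes i k i≢k (yes k≡i) = contradiction (sym k≡i) i≢k
  factor-vanishes i k i≢k (no k≢i) = trans (eval-separating-factor i k k≢i (P k)) (ℤ.+-inverseʳ (P k (separator i k k≢i)))

  factor-≢0 : ∀ i k (k≟i : Dec (k ≡ i)) → eval (factor i k k≟i) (P i) ≢ 0ℤ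
  factor-≢0 i k (yes _) = subst (_≢ 0ℤ) (sym (eval-var (P i) j)) (proj₂ (nonzero-coordinate i))
    where j = proj₁ (nonzero-coordinate i)
  factor-≢0 i k (no k≢i) ≡0 = proj₂ (separating-coordinate i k (k≢i ∘ sym))
    (ℤ.i-j≡0⇒i≡j (P i j) (P k j) (trans (sym (eval-separating-factor i k k≢i (P i))) ≡0))
    where j = separator i k k≢i

  basis : Fin s → Poly r
  basis i = ∏ₚ λ k → factor i k (k ≟ i)

  eval-basis : ∀ i x → eval (basis i) x ≡ ∏ (λ k → eval (factor i k (k ≟ i)) x)
  eval-basis i x = eval-∏ₚ x (λ k → factor i k (k ≟ i))

  basis-degree : ∀ i → DegreeAtMost (basis i) s
  basis-degree i = ∏ₚ-degree (λ k → factor i k (k ≟ i)) (λ k → factor-degree i k (k ≟ i))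

  basis-origin : ∀ i → eval (basis i) origin ≡ 0ℤ
  basis-origin i = trans (eval-basis i origin) (∏-≡0 _ i (factor-origin i (i ≟ i)))

  basis-vanishes : ∀ i k → i ≢ k → eval (basis i) (P k) ≡ 0ℤ
  basis-vanishes i k i≢k = trans (eval-basis i (P k)) (∏-≡0 _ k (factor-vanishes i k i≢k (k ≟ i)))

  basis-≢0 : ∀ i → eval (basis i) (P i) ≢ 0ℤ
  basis-≢0 i = subst (_≢ 0ℤ) (sym (eval-basis i (P i))) (∏-≢0 _ (λ k → factor-≢0 i k (k ≟ i)))

  modulus : ℕ
  modulus = ∣ ∏ (λ i → eval (basis i) (P i)) ∣

  modulus-positive : 0 < modulus
  modulus-positive = ℕ.n≢0⇒n>0 (∏-≢0 (λ i → eval (basis i) (P i)) basis-≢0 ∘ ℤ.∣i∣≡0⇒i≡0)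

  module _ (b : Fin s → ℤ) (modulus∣b : ∀ i → + modulus ∣ b i) where

    basis-value∣b : ∀ i → eval (basis i) (P i) Signed.∣ b i
    basis-value∣b i = Signed.∣-trans (∣∏ (λ k → eval (basis k) (P k)) i) (Signed.∣ᵤ⇒∣ (modulus∣b i))

    coefficient : Fin s → ℤ
    coefficient i = Signed.quotient (basis-value∣b i)

    interpolant : Poly r
    interpolant = ∑ₚ λ i → const (coefficient i) *ₚ basis i

    eval-interpolant : ∀ x → eval interpolant x ≡ ∑ (λ i → coefficient i * eval (basis i) x)
    eval-interpolant x = trans (eval-∑ₚ x (λ i → const (coefficient i) *ₚ basis i)) (∑-cong λ i →
      trans (eval-*ₚ x (const (coefficient i)) (basis i)) (cong (_* eval (basis i) x) (eval-const x (coefficient i))))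

    interpolant-degree : DegreeAtMost interpolant s
    interpolant-degree = ∑ₚ-degree (λ i → const (coefficient i) *ₚ basis i) λ i →
      *ₚ-degree (const (coefficient i)) (basis i) (const-degree (coefficient i) 0) (basis-degree i)

    interpolant-origin : eval interpolant origin ≡ 0ℤ
    interpolant-origin = begin
      eval interpolant origin                          ≡⟨ eval-interpolant origin ⟩
      ∑ (λ i → coefficient i * eval (basis i) origin)  ≡⟨ ∑-cong (λ i → cong (coefficient i *_) (basis-origin i)) ⟩
      ∑ (λ i → coefficient i * 0ℤ)                     ≡⟨ ∑-cong (λ i → ℤ.*-zeroʳ (coefficient i)) ⟩
      ∑ {s} (λ _ → 0ℤ)                                 ≡⟨ ∑-zero s ⟩
      0ℤ                                               ∎
      where open ≡-Reasoning

    interpolant-interpolates : ∀ k → eval interpolant (P k) ≡ b k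
    interpolant-interpolates k = begin
      eval interpolant (P k)                           ≡⟨ eval-interpolant (P k) ⟩
      ∑ (λ i → coefficient i * eval (basis i) (P k))   ≡⟨ ∑-single _ k off-diagonal ⟩
      coefficient k * eval (basis k) (P k)             ≡⟨ Signed._∣_.equality (basis-value∣b k) ⟨
      b k                                              ∎
      where
      open ≡-Reasoning
      off-diagonal : ∀ i → i ≢ k → coefficient i * eval (basis i) (P k) ≡ 0ℤ
      off-diagonal i i≢k = trans (cong (coefficient i *_) (basis-vanishes i k i≢k)) (ℤ.*-zeroʳ (coefficient i))

  interpolation : Σ ℕ λ c → (0 < c) × ((b : Fin s → ℤ) → (∀ i → + c ∣ b i)
    → Σ (Poly r) λ p → DegreeAtMost p s × (eval p origin ≡ 0ℤ) × (∀ i → eval p (P i) ≡ b i))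
  interpolation = modulus , modulus-positive , λ b modulus∣b →
    interpolant b modulus∣b , interpolant-degree b modulus∣b , interpolant-origin b modulus∣b , interpolant-interpolates b modulus∣b

lemma19 : (r s : ℕ) (t : Fin r → Fin s → ℕ)
    → (∀ (i : Fin s) → ∃ λ (j : Fin r) → t j i ≢ 0)
    → (∀ (i i′ : Fin s) → i ≢ i′ → ∃ λ (j : Fin r) → t j i ≢ t j i′)
    → Σ ℕ λ c → (0 < c) × ((b : Fin s → ℤ) → (∀ i → (+ c) ∣ b i)
        → Σ (Poly r) λ p → DegreeAtMost p s
          × (eval p (λ _ → + 0) ≡ + 0)
          × (∀ (i : Fin s) → eval p (λ j → + (t j i)) ≡ b i))
lemma19 r s t nonzero separated = Interpolation.interpolation (λ i j → + t j i)
  (λ i → map₂ (_∘ ℤ.+-injective) (nonzero i))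
  (λ i i′ i≢i′ → map₂ (_∘ ℤ.+-injective) (separated i i′ i≢i′))
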